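{- For all $n\geq 3$, $$B_{n}^{neobc}=35B_{n-1}^{neobc}-35B_{n-2}^{neobc}+B_{n-3}^{neobc},\quad C_{n}^{neobc}=35C_{n-1}^{neobc}-35C_{n-2}^{neobc}+C_{n-3}^{neobc},$$ $$R_{n}^{neobc}=35R_{n-1}^{neobc}-35R_{n-2}^{neobc}+R_{n-3}^{neobc},$$ and for all $n\geq 4$, $$CR_{n}^{neobc}=35CR_{n-1}^{neobc}-35CR_{n-2}^{neobc}+CR_{n-3}^{neobc}.$$
   Context: A positive integer $m$ is a neo balcobalancing number if there is a positive integer $r$ (its neo balcobalancer) such that $(1+2+\cdots+(m-1))+(1+2+\cdots+m)=2[(m-1)+m+(m+1)+(m+2)+\cdots+(m+r)]$; then $r=\frac{ -2m-1+\sqrt{8m^2-12m+9}}{2}$ (equivalently, $m$ is a neo balcobalancing number iff $8m^2-12m+9$ is a perfect square). For $n\ge1$, $B_n^{neobc}$ denotes the $n$-th neo balcobalancing number in increasing order, $R_n^{neobc}$ its neo balcobalancer, $C_n^{neobc}=\sqrt{8(B_n^{neobc})^2-12B_n^{neobc}+9}$ and $CR_n^{neobc}=\sqrt{2(R_n^{neobc})^2+5R_n^{neobc}+2}$. By convention, $B_0^{neobc}=0$, $R_0^{neobc}=1$, $C_0^{neobc}=CR_0^{neobc}=3$. -}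

module Defs where

open import Data.Nat using (ℕ; zero; suc; _+_; _*_; _∸_; _≤_; _<_)
open import Data.List using (upTo; applyUpTo)
open import Data.Nat.ListAction using (sum)
open import Data.Integer as ℤ using (ℤ; +_)
open import Data.Product using (Σ; ∃; _×_)
open import Relation.Binary.PropositionalEquality using (_≡_)

triSumBelow : ℕ → ℕ
triSumBelow m = sum (upTo m)

rightSum : ℕ → ℕ → ℕ
rightSum m r = sum (applyUpTo (λ i → (m ∸ 1) + i) (r + 2))

IsNeoBalcobalancer : ℕ → ℕ → Set
IsNeoBalcobalancer m r =
  1 ≤ m × 1 ≤ r × (triSumBelow m + triSumBelow (suc m) ≡ 2 * rightSum m r)

IsNeoBC : ℕ → Set
IsNeoBC m = ∃ λ r → IsNeoBalcobalancer m r

-- b enumerates the neo balcobalancing numbers in increasing order,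
-- with the convention b 0 = 0: b n = B_n^{neobc}.
IsNeoBCEnumeration : (ℕ → ℕ) → Set
IsNeoBCEnumeration b =
  (b 0 ≡ 0)
  × (∀ n → b n < b (suc n))
  × (∀ n → 1 ≤ n → IsNeoBC (b n))
  × (∀ m → IsNeoBC m → ∃ λ n → b n ≡ m)

-- r n = R_n^{neobc}: the neo balcobalancer of b n, with convention r 0 = 1
IsNeoBCBalancerSeq : (ℕ → ℕ) → (ℕ → ℕ) → Set
IsNeoBCBalancerSeq b r =
  (r 0 ≡ 1) × (∀ n → 1 ≤ n → IsNeoBalcobalancer (b n) (r n))

-- c n = C_n^{neobc} = sqrt(8 b_n^2 - 12 b_n + 9)  (nonnegative root; gives c 0 = 3)
IsNeoBCCSeq : (ℕ → ℕ) → (ℕ → ℕ) → Set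
IsNeoBCCSeq b c = ∀ n →
  (+ c n) ℤ.* (+ c n) ≡ (+ 8) ℤ.* (+ b n) ℤ.* (+ b n) ℤ.- (+ 12) ℤ.* (+ b n) ℤ.+ (+ 9)

-- cr n = CR_n^{neobc} = sqrt(2 r_n^2 + 5 r_n + 2)  (gives cr 0 = 3)
IsNeoBCCRSeq : (ℕ → ℕ) → (ℕ → ℕ) → Set
IsNeoBCCRSeq r cr = ∀ n →
  cr n * cr n ≡ 2 * r n * r n + 5 * r n + 2

Rec35 : (ℕ → ℕ) → ℕ → Set
Rec35 x n = (+ x n) ≡ (+ 35) ℤ.* (+ x (n ∸ 1)) ℤ.- (+ 35) ℤ.* (+ x (n ∸ 2)) ℤ.+ (+ x (n ∸ 3))

-- With k = 2m + 2r + 1, the balancing condition becomes the Pell-type equation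
-- k² = 8m² − 12m + 9, i.e. (4m − 3)² − 2k² = −9. Its solutions in ℕ form a single
-- orbit starting at (m , k) = (0 , 3) under multiplication of (4m − 3) + k√2 by the
-- unit 17 + 12√2: the inverse step strictly decreases m as long as m ≥ 6, and no
-- 1 ≤ m ≤ 5 is a solution. Hence B, R, C and CR are explicit affine functions of
-- the orbit, each satisfying x(n+2) = 34 x(n+1) − x(n) + κ for some constant κ;
-- differencing two consecutive instances kills κ and gives the recurrence with
-- characteristic polynomial (λ − 1)(λ² − 34λ + 1) = λ³ − 35λ² + 35λ − 1.
-- For CR the affine formula CR = B − R − 2 only holds from n = 1 on.
module Submission where

open import Defs
open import Data.Nat using (ℕ; _≤_)
open import Data.Product using (_×_)

open import Data.Nat using (zero; suc; _+_; _*_; _∸_; _<_; z≤n; s≤s; _≤?_; _<?_)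
open import Data.Nat.Properties
open import Data.Nat.Induction using (<-rec)
open import Data.Nat.ListAction using (sum)
open import Data.Nat.ListAction.Properties using (sum-++)
import Data.Nat.Tactic.RingSolver as ℕ-Solver
open import Data.List using (applyUpTo; _∷ʳ_; [_])
open import Data.List.Properties using (applyUpTo-∷ʳ)
open import Data.Integer as ℤ using (ℤ)
import Data.Integer.Properties as ℤ
import Data.Integer.Tactic.RingSolver as ℤ-Solver
open import Data.Product using (∃; ∃₂; _,_)
open import Data.Sum using (inj₁; inj₂)
open import Data.Empty using (⊥-elim)
open import Function using (id)
open import Relation.Nullary using (yes; no; contradiction)
open import Relation.Nullary.Decidable using (True; toWitness)
open import Relation.Binary.PropositionalEquality hiding ([_])

open ℕ-Solver using (solve-∀)

m*m≤n*n⇒m≤n : ∀ {m n} → m * m ≤ n * n → m ≤ n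
m*m≤n*n⇒m≤n {m} {n} m²≤n² with m ≤? n
... | yes m≤n = m≤n
... | no m≰n = contradiction m²≤n² (<⇒≱ (*-mono-< (≰⇒> m≰n) (≰⇒> m≰n)))

m*m<n*n⇒m<n : ∀ {m n} → m * m < n * n → m < n
m*m<n*n⇒m<n {m} {n} m²<n² with n ≤? m
... | yes n≤m = contradiction (*-mono-≤ n≤m n≤m) (<⇒≱ m²<n²)
... | no n≰m = ≰⇒> n≰m

m*m≡n*n⇒m≡n : ∀ {m n} → m * m ≡ n * n → m ≡ n
m*m≡n*n⇒m≡n m²≡n² =
  ≤-antisym (m*m≤n*n⇒m≤n (≤-reflexive m²≡n²)) (m*m≤n*n⇒m≤n (≤-reflexive (sym m²≡n²)))

nonsquare : ∀ j {N} k {j²<N : True (j * j <? N)} {N<[1+j]² : True (N <? suc j * suc j)} →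
            k * k ≢ N
nonsquare j k {j²<N} {N<[1+j]²} refl =
  <⇒≱ (toWitness N<[1+j]²) (*-mono-≤ j<k j<k)
  where
  j<k : j < k
  j<k = m*m<n*n⇒m<n (toWitness j²<N)

sum-applyUpTo-suc : ∀ (f : ℕ → ℕ) n → sum (applyUpTo f (suc n)) ≡ sum (applyUpTo f n) + f n
sum-applyUpTo-suc f n = begin
  sum (applyUpTo f (suc n))          ≡⟨ cong sum (applyUpTo-∷ʳ f n) ⟨
  sum (applyUpTo f n ∷ʳ f n)         ≡⟨ sum-++ (applyUpTo f n) [ f n ] ⟩
  sum (applyUpTo f n) + (f n + 0)    ≡⟨ cong (sum (applyUpTo f n) +_) (+-identityʳ (f n)) ⟩
  sum (applyUpTo f n) + f n          ∎
  where open ≡-Reasoning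

twice-sum-range : ∀ p n → 2 * sum (applyUpTo (p +_) n) + n ≡ n * (2 * p + n)
twice-sum-range p zero = refl
twice-sum-range p (suc n) = begin
  2 * sum (applyUpTo (p +_) (suc n)) + suc n   ≡⟨ cong (λ s → 2 * s + suc n) (sum-applyUpTo-suc (p +_) n) ⟩
  2 * (s + (p + n)) + suc n                    ≡⟨ regroup s p n ⟩
  (2 * s + n) + (2 * (p + n) + 1)              ≡⟨ cong (_+ (2 * (p + n) + 1)) (twice-sum-range p n) ⟩
  n * (2 * p + n) + (2 * (p + n) + 1)          ≡⟨ expand p n ⟩
  suc n * (2 * p + suc n)                      ∎
  where
  open ≡-Reasoning
  s = sum (applyUpTo (p +_) n)
  regroup : ∀ s p n → 2 * (s + (p + n)) + suc n ≡ (2 * s + n) + (2 * (p + n) + 1)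
  regroup = solve-∀
  expand : ∀ p n → n * (2 * p + n) + (2 * (p + n) + 1) ≡ suc n * (2 * p + suc n)
  expand = solve-∀

triSumBelow-+-suc : ∀ m → triSumBelow m + triSumBelow (suc m) ≡ m * m
triSumBelow-+-suc m = begin
  t + triSumBelow (suc m)   ≡⟨ cong (t +_) (sum-applyUpTo-suc id m) ⟩
  t + (t + m)               ≡⟨ double t m ⟩
  2 * t + m                 ≡⟨ twice-sum-range 0 m ⟩
  m * m                     ∎
  where
  open ≡-Reasoning
  t = triSumBelow m
  double : ∀ t m → t + (t + m) ≡ 2 * t + m
  double = solve-∀

twice-rightSum : ∀ p r → 2 * rightSum (suc p) r + (r + 2) ≡ (r + 2) * (2 * suc p + r)
twice-rightSum p r = trans (twice-sum-range p (r + 2)) (regroup p r)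
  where
  regroup : ∀ p r → (r + 2) * (2 * p + (r + 2)) ≡ (r + 2) * (2 * suc p + r)
  regroup = solve-∀

-- The balancing equation and the Pell equation

-- m² = (r + 2)(2m + r − 1), with the truncated subtraction moved across
NeoBalancingEq : ℕ → ℕ → Set
NeoBalancingEq m r = m * m + (r + 2) ≡ (r + 2) * (2 * m + r)

isNeoBalcobalancer⇒eq : ∀ {m r} → IsNeoBalcobalancer m r → NeoBalancingEq m r
isNeoBalcobalancer⇒eq {suc p} {r} (_ , _ , balanced) = begin
  suc p * suc p + (r + 2)                                ≡⟨ cong (_+ (r + 2)) (triSumBelow-+-suc (suc p)) ⟨
  triSumBelow (suc p) + triSumBelow (suc (suc p)) + (r + 2) ≡⟨ cong (_+ (r + 2)) balanced ⟩
  2 * rightSum (suc p) r + (r + 2)                       ≡⟨ twice-rightSum p r ⟩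
  (r + 2) * (2 * suc p + r)                              ∎
  where open ≡-Reasoning

eq⇒isNeoBalcobalancer : ∀ {m r} → 1 ≤ m → 1 ≤ r → NeoBalancingEq m r → IsNeoBalcobalancer m r
eq⇒isNeoBalcobalancer {suc p} {r} 1≤m 1≤r eq = 1≤m , 1≤r , +-cancelʳ-≡ (r + 2) _ _ (begin
  triSumBelow (suc p) + triSumBelow (suc (suc p)) + (r + 2) ≡⟨ cong (_+ (r + 2)) (triSumBelow-+-suc (suc p)) ⟩
  suc p * suc p + (r + 2)                                ≡⟨ eq ⟩
  (r + 2) * (2 * suc p + r)                              ≡⟨ twice-rightSum p r ⟨
  2 * rightSum (suc p) r + (r + 2)                       ∎)
  where open ≡-Reasoning

-- k² = 8m² − 12m + 9, with the negative term moved across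
NeoPell : ℕ → ℕ → Set
NeoPell m k = k * k + 12 * m ≡ 8 * m * m + 9

-- Reduces an identity modulo the Pell equation to a polynomial identity.
pell-cancel : ∀ {m k} → NeoPell m k → ∀ a {x y} →
              x + a * (8 * m * m + 9) ≡ y + a * (k * k + 12 * m) → x ≡ y
pell-cancel {m} {k} pell a {x} {y} identity =
  +-cancelʳ-≡ (a * (8 * m * m + 9)) x y (trans identity (cong (λ t → y + a * t) pell))

eq⇒pell : ∀ {m r} → NeoBalancingEq m r → NeoPell m (2 * m + 2 * r + 1)
eq⇒pell {m} {r} eq = +-cancelʳ-≡ (4 * ((r + 2) * (2 * m + r))) _ _ (begin
  k * k + 12 * m + 4 * ((r + 2) * (2 * m + r))  ≡⟨ cong (λ t → k * k + 12 * m + 4 * t) eq ⟨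
  k * k + 12 * m + 4 * (m * m + (r + 2))        ≡⟨ identity m r ⟩
  8 * m * m + 9 + 4 * ((r + 2) * (2 * m + r))   ∎)
  where
  open ≡-Reasoning
  k = 2 * m + 2 * r + 1
  identity : ∀ m r → let k = 2 * m + 2 * r + 1 in
             k * k + 12 * m + 4 * (m * m + (r + 2)) ≡ 8 * m * m + 9 + 4 * ((r + 2) * (2 * m + r))
  identity = solve-∀

pell-unique : ∀ {m k k′} → NeoPell m k → NeoPell m k′ → k ≡ k′
pell-unique {m} pell pell′ = m*m≡n*n⇒m≡n (+-cancelʳ-≡ (12 * m) _ _ (trans pell (sym pell′)))

balancingEq-unique : ∀ {m r r′} → NeoBalancingEq m r → NeoBalancingEq m r′ → r ≡ r′
balancingEq-unique {m} {r} {r′} eq eq′ =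
  *-cancelˡ-≡ r r′ 2 (+-cancelˡ-≡ (2 * m) _ _ (+-cancelʳ-≡ 1 _ _ (pell-unique {m} (eq⇒pell {m} {r} eq) (eq⇒pell {m} {r′} eq′))))

-- The orbit of (0 , 3)

-- One step multiplies (4B − 3) + C√2 by 17 + 12√2; Q = R − 1 avoids subtraction.
mutual
  neoB : ℕ → ℕ
  neoB zero = 0
  neoB (suc n) = 29 * neoB n + 12 * neoQ n + 6

  neoQ : ℕ → ℕ
  neoQ zero = 0
  neoQ (suc n) = 12 * neoB n + 5 * neoQ n

neoR : ℕ → ℕ
neoR n = suc (neoQ n)

neoC : ℕ → ℕ
neoC n = 2 * neoB n + 2 * neoR n + 1

neo-balancingEq : ∀ n → NeoBalancingEq (neoB n) (neoR n)
neo-balancingEq zero = refl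
neo-balancingEq (suc n) = +-cancelʳ-≡ ((R + 2) * (2 * B + R)) _ _ (begin
  B′ * B′ + (R′ + 2) + (R + 2) * (2 * B + R)      ≡⟨ identity B (neoQ n) ⟩
  (R′ + 2) * (2 * B′ + R′) + (B * B + (R + 2))    ≡⟨ cong ((R′ + 2) * (2 * B′ + R′) +_) (neo-balancingEq n) ⟩
  (R′ + 2) * (2 * B′ + R′) + (R + 2) * (2 * B + R) ∎)
  where
  open ≡-Reasoning
  B = neoB n
  R = neoR n
  B′ = neoB (suc n)
  R′ = neoR (suc n)
  identity : ∀ B Q → let R = suc Q; B′ = 29 * B + 12 * Q + 6; R′ = suc (12 * B + 5 * Q) in
             B′ * B′ + (R′ + 2) + (R + 2) * (2 * B + R) ≡ (R′ + 2) * (2 * B′ + R′) + (B * B + (R + 2))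
  identity = solve-∀

neo-pell : ∀ n → NeoPell (neoB n) (neoC n)
neo-pell n = eq⇒pell {neoB n} {neoR n} (neo-balancingEq n)

neoB-< : ∀ n → neoB n < neoB (suc n)
neoB-< n = subst (suc (neoB n) ≤_) (sym (split (neoB n) (neoQ n))) (m≤m+n _ _)
  where
  split : ∀ B Q → 29 * B + 12 * Q + 6 ≡ suc B + (28 * B + 12 * Q + 5)
  split = solve-∀

-- Every solution of the Pell equation lies on the orbit

PellStep : ℕ → ℕ → ℕ → ℕ → Set
PellStep m′ k′ m k = m + 12 ≡ 17 * m′ + 6 * k′ × k + 36 ≡ 48 * m′ + 17 * k′

neo-step : ∀ n → PellStep (neoB n) (neoC n) (neoB (suc n)) (neoC (suc n))
neo-step n = stepB (neoB n) (neoQ n) , stepC (neoB n) (neoQ n)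
  where
  stepB : ∀ B Q → 29 * B + 12 * Q + 6 + 12 ≡ 17 * B + 6 * (2 * B + 2 * suc Q + 1)
  stepB = solve-∀
  stepC : ∀ B Q → let B′ = 29 * B + 12 * Q + 6; Q′ = 12 * B + 5 * Q in
          2 * B′ + 2 * suc Q′ + 1 + 36 ≡ 48 * B + 17 * (2 * B + 2 * suc Q + 1)
  stepC = solve-∀

pellStep-functional : ∀ {m′ k′ m₁ k₁ m₂ k₂} → PellStep m′ k′ m₁ k₁ → PellStep m′ k′ m₂ k₂ →
                      m₁ ≡ m₂ × k₁ ≡ k₂
pellStep-functional (m₁≡ , k₁≡) (m₂≡ , k₂≡) =
  +-cancelʳ-≡ 12 _ _ (trans m₁≡ (sym m₂≡)) , +-cancelʳ-≡ 36 _ _ (trans k₁≡ (sym k₂≡))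

-- The step matrix has determinant 1; 17·e₁ + 6·e₂ and 48·e₁ + 17·e₂ solve for m′ and k′.
pellStep⁻¹ : ∀ {m k m′ k′} → 6 * k + 12 + m′ ≡ 17 * m → 48 * m + k′ ≡ 17 * k + 36 →
             PellStep m′ k′ m k
pellStep⁻¹ {m} {k} {m′} {k′} e₁ e₂ =
  +-cancelʳ-≡ (102 * k + 204 + 288 * m) _ _ (begin
    m + 12 + (102 * k + 204 + 288 * m)                  ≡⟨ m-side m k ⟩
    17 * (17 * m) + 6 * (17 * k + 36)                   ≡⟨ cong₂ (λ s t → 17 * s + 6 * t) e₁ e₂ ⟨
    17 * (6 * k + 12 + m′) + 6 * (48 * m + k′)          ≡⟨ m′-side m k m′ k′ ⟩
    17 * m′ + 6 * k′ + (102 * k + 204 + 288 * m)        ∎) ,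
  +-cancelʳ-≡ (288 * k + 576 + 816 * m) _ _ (begin
    k + 36 + (288 * k + 576 + 816 * m)                  ≡⟨ k-side m k ⟩
    48 * (17 * m) + 17 * (17 * k + 36)                  ≡⟨ cong₂ (λ s t → 48 * s + 17 * t) e₁ e₂ ⟨
    48 * (6 * k + 12 + m′) + 17 * (48 * m + k′)         ≡⟨ k′-side m k m′ k′ ⟩
    48 * m′ + 17 * k′ + (288 * k + 576 + 816 * m)       ∎)
  where
  open ≡-Reasoning
  m-side : ∀ m k → m + 12 + (102 * k + 204 + 288 * m) ≡ 17 * (17 * m) + 6 * (17 * k + 36)
  m-side = solve-∀
  m′-side : ∀ m k m′ k′ → 17 * (6 * k + 12 + m′) + 6 * (48 * m + k′) ≡ 17 * m′ + 6 * k′ + (102 * k + 204 + 288 * m)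
  m′-side = solve-∀
  k-side : ∀ m k → k + 36 + (288 * k + 576 + 816 * m) ≡ 48 * (17 * m) + 17 * (17 * k + 36)
  k-side = solve-∀
  k′-side : ∀ m k m′ k′ → 48 * (6 * k + 12 + m′) + 17 * (48 * m + k′) ≡ 48 * m′ + 17 * k′ + (288 * k + 576 + 816 * m)
  k′-side = solve-∀

-- In M = m + 12 and K = k + 36 the equation reads K² + 204M = 8M² + 72K + 9,
-- and K² + 204M − 8M² − 72K is invariant under the linear part of the step.
pellStep-reflects-pell : ∀ {m′ k′ m k} → PellStep m′ k′ m k → NeoPell m k → NeoPell m′ k′
pellStep-reflects-pell {m′} {k′} {m} {k} (m+12≡M , k+36≡K) pell =
  +-cancelʳ-≡ (8 * M * M + 72 * K) _ _ (begin
    k′ * k′ + 12 * m′ + (8 * M * M + 72 * K)   ≡⟨ invariance m′ k′ ⟩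
    8 * m′ * m′ + (K * K + 204 * M)            ≡⟨ cong (8 * m′ * m′ +_) shifted ⟩
    8 * m′ * m′ + (8 * M * M + 72 * K + 9)     ≡⟨ regroup (8 * m′ * m′) (8 * M * M + 72 * K) ⟩
    8 * m′ * m′ + 9 + (8 * M * M + 72 * K)     ∎)
  where
  open ≡-Reasoning
  M = 17 * m′ + 6 * k′
  K = 48 * m′ + 17 * k′
  shift : ∀ m k → (k + 36) * (k + 36) + 204 * (m + 12) + 1 * (8 * m * m + 9)
                  ≡ 8 * (m + 12) * (m + 12) + 72 * (k + 36) + 9 + 1 * (k * k + 12 * m)
  shift = solve-∀
  shifted : K * K + 204 * M ≡ 8 * M * M + 72 * K + 9
  shifted = subst₂ (λ M K → K * K + 204 * M ≡ 8 * M * M + 72 * K + 9) m+12≡M k+36≡K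
                   (pell-cancel {m} {k} pell 1 (shift m k))
  invariance : ∀ m′ k′ → let M = 17 * m′ + 6 * k′; K = 48 * m′ + 17 * k′ in
               k′ * k′ + 12 * m′ + (8 * M * M + 72 * K) ≡ 8 * m′ * m′ + (K * K + 204 * M)
  invariance = solve-∀
  regroup : ∀ a b → a + (b + 9) ≡ a + 9 + b
  regroup = solve-∀

-- The bounds below compare squares; m = 6 + q keeps both sides free of subtraction.
pell-bound₁ : ∀ {q k} → NeoPell (6 + q) k → 6 * k + 12 ≤ 17 * (6 + q)
pell-bound₁ {q} {k} pell =
  subst (6 * k + 12 ≤_) (shift q) (+-monoˡ-≤ 12 root-bound)
  where
  identity : ∀ q k → 6 * k * (6 * k) + (q * q + 36 * q) + 36 * (8 * (6 + q) * (6 + q) + 9)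
                     ≡ (90 + 17 * q) * (90 + 17 * q) + 36 * (k * k + 12 * (6 + q))
  identity = solve-∀
  squares : 6 * k * (6 * k) + (q * q + 36 * q) ≡ (90 + 17 * q) * (90 + 17 * q)
  squares = pell-cancel {6 + q} {k} pell 36 (identity q k)
  root-bound : 6 * k ≤ 90 + 17 * q
  root-bound = m*m≤n*n⇒m≤n (≤-trans (m≤m+n _ _) (≤-reflexive squares))
  shift : ∀ q → 90 + 17 * q + 12 ≡ 17 * (6 + q)
  shift = solve-∀

pell-bound₂ : ∀ {q k} → NeoPell (6 + q) k → 48 * (6 + q) ≤ 17 * k + 36
pell-bound₂ {q} {k} pell =
  subst (_≤ 17 * k + 36) (shift q) (+-monoˡ-≤ 36 root-bound)
  where
  identity : ∀ q k → 17 * k * (17 * k) + 289 * (8 * (6 + q) * (6 + q) + 9)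
                     ≡ (252 + 48 * q) * (252 + 48 * q) + (1521 + 84 * q + 8 * q * q) + 289 * (k * k + 12 * (6 + q))
  identity = solve-∀
  squares : 17 * k * (17 * k) ≡ (252 + 48 * q) * (252 + 48 * q) + (1521 + 84 * q + 8 * q * q)
  squares = pell-cancel {6 + q} {k} pell 289 (identity q k)
  root-bound : 252 + 48 * q ≤ 17 * k
  root-bound = m*m≤n*n⇒m≤n (≤-trans (m≤m+n _ _) (≤-reflexive (sym squares)))
  shift : ∀ q → 252 + 48 * q + 36 ≡ 48 * (6 + q)
  shift = solve-∀

pell-bound₃ : ∀ {q k} → NeoPell (6 + q) k → 16 * (6 + q) < 6 * k + 12
pell-bound₃ {q} {k} pell =
  subst (_< 6 * k + 12) (shift q) (+-monoˡ-< 12 root-bound)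
  where
  identity : ∀ q k → 6 * k * (6 * k) + 36 * (8 * (6 + q) * (6 + q) + 9)
                     ≡ 1 + ((84 + 16 * q) * (84 + 16 * q) + (1043 + 336 * q + 32 * q * q)) + 36 * (k * k + 12 * (6 + q))
  identity = solve-∀
  squares : 6 * k * (6 * k) ≡ 1 + ((84 + 16 * q) * (84 + 16 * q) + (1043 + 336 * q + 32 * q * q))
  squares = pell-cancel {6 + q} {k} pell 36 (identity q k)
  root-bound : 84 + 16 * q < 6 * k
  root-bound = m*m<n*n⇒m<n (≤-trans (m≤m+n _ _) (≤-reflexive (sym squares)))
  shift : ∀ q → 84 + 16 * q + 12 ≡ 16 * (6 + q)
  shift = solve-∀

pell-descent-step : ∀ q k → NeoPell (6 + q) k →
                    ∃₂ λ m′ k′ → m′ < 6 + q × NeoPell m′ k′ × PellStep m′ k′ (6 + q) k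
pell-descent-step q k pell = m′ , k′ , m′<m , pellStep-reflects-pell {m′} {k′} {m} {k} step pell , step
  where
  m = 6 + q
  m′ = 17 * m ∸ (6 * k + 12)
  k′ = 17 * k + 36 ∸ 48 * m
  e₁ : 6 * k + 12 + m′ ≡ 17 * m
  e₁ = m+[n∸m]≡n (pell-bound₁ {q} {k} pell)
  e₂ : 48 * m + k′ ≡ 17 * k + 36
  e₂ = m+[n∸m]≡n (pell-bound₂ {q} {k} pell)
  step : PellStep m′ k′ m k
  step = pellStep⁻¹ {m} {k} e₁ e₂
  m′<m : m′ < m
  m′<m = +-cancelˡ-< (16 * m) m′ m (begin-strict
    16 * m + m′        <⟨ +-monoˡ-< m′ (pell-bound₃ {q} {k} pell) ⟩
    6 * k + 12 + m′    ≡⟨ e₁ ⟩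
    17 * m             ≡⟨ +-comm m (16 * m) ⟩
    16 * m + m         ∎)
    where open ≤-Reasoning

pell⇒neo : ∀ m k → NeoPell m k → ∃ λ n → neoB n ≡ m × neoC n ≡ k
pell⇒neo = <-rec _ descend
  where
  descend : ∀ m → (∀ {m′} → m′ < m → ∀ k → NeoPell m′ k → ∃ λ n → neoB n ≡ m′ × neoC n ≡ k) →
            ∀ k → NeoPell m k → ∃ λ n → neoB n ≡ m × neoC n ≡ k
  descend 0 _ k pell = 0 , refl , m*m≡n*n⇒m≡n (sym (trans (sym (+-identityʳ (k * k))) pell))
  descend 1 _ k pell = ⊥-elim (nonsquare 2 k (+-cancelʳ-≡ 12 _ 5 pell))
  descend 2 _ k pell = ⊥-elim (nonsquare 4 k (+-cancelʳ-≡ 24 _ 17 pell))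
  descend 3 _ k pell = ⊥-elim (nonsquare 6 k (+-cancelʳ-≡ 36 _ 45 pell))
  descend 4 _ k pell = ⊥-elim (nonsquare 9 k (+-cancelʳ-≡ 48 _ 89 pell))
  descend 5 _ k pell = ⊥-elim (nonsquare 12 k (+-cancelʳ-≡ 60 _ 149 pell))
  descend (suc (suc (suc (suc (suc (suc q)))))) smaller k pell =
    let m′ , k′ , m′<m , pell′ , step = pell-descent-step q k pell
        n , neoB≡m′ , neoC≡k′ = smaller m′<m k′ pell′
        neo-step′ = subst₂ (λ a b → PellStep a b (neoB (suc n)) (neoC (suc n))) neoB≡m′ neoC≡k′ (neo-step n)
    in suc n , pellStep-functional {m′} {k′} neo-step′ step

module _ {f : ℕ → ℕ} (f-< : ∀ n → f n < f (suc n)) where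

  increasing⇒mono-≤ : ∀ {m n} → m ≤ n → f m ≤ f n
  increasing⇒mono-≤ {m} {zero} z≤n = ≤-refl
  increasing⇒mono-≤ {m} {suc n} m≤1+n with m≤n⇒m<n∨m≡n m≤1+n
  ... | inj₁ (s≤s m≤n) = ≤-trans (increasing⇒mono-≤ m≤n) (<⇒≤ (f-< n))
  ... | inj₂ refl = ≤-refl

  increasing⇒mono-< : ∀ {m n} → m < n → f m < f n
  increasing⇒mono-< {m} m<n = <-≤-trans (f-< m) (increasing⇒mono-≤ m<n)

increasing-agreeing-below⇒≤ : ∀ {f g n} → (∀ n → f n < f (suc n)) → (∀ n → g n < g (suc n)) →
                              (∀ {i} → i < n → f i ≡ g i) → ∃ (λ j → f j ≡ g n) → f n ≤ g n
increasing-agreeing-below⇒≤ {f} {g} {n} f-< g-< agree (j , fj≡gn) with j <? n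
... | yes j<n = contradiction (trans (sym (agree j<n)) fj≡gn) (<⇒≢ (increasing⇒mono-< {g} g-< j<n))
... | no j≮n = subst (f n ≤_) fj≡gn (increasing⇒mono-≤ {f} f-< (≮⇒≥ j≮n))

increasing-same-image⇒≗ : ∀ {f g} → (∀ n → f n < f (suc n)) → (∀ n → g n < g (suc n)) →
                          (∀ n → ∃ λ j → g j ≡ f n) → (∀ n → ∃ λ j → f j ≡ g n) → f ≗ g
increasing-same-image⇒≗ {f} {g} f-< g-< f⊆g g⊆f = <-rec _ agree
  where
  agree : ∀ n → (∀ {i} → i < n → f i ≡ g i) → f n ≡ g n
  agree n below = ≤-antisym
    (increasing-agreeing-below⇒≤ {f} {g} f-< g-< below (g⊆f n))
    (increasing-agreeing-below⇒≤ {g} {f} g-< f-< (λ i<n → sym (below i<n)) (f⊆g n))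

-- Identification of the four sequences

isNeoBC⇒neoB : ∀ {m} → IsNeoBC m → ∃ λ n → neoB n ≡ m
isNeoBC⇒neoB {m} (r , balancer) =
  let n , neoB≡m , _ = pell⇒neo m (2 * m + 2 * r + 1) (eq⇒pell {m} {r} (isNeoBalcobalancer⇒eq balancer))
  in n , neoB≡m

neoB-isNeoBC : ∀ n → IsNeoBC (neoB (suc n))
neoB-isNeoBC n =
  neoR (suc n) , eq⇒isNeoBalcobalancer {neoB (suc n)} (≤-trans (s≤s z≤n) (neoB-< n)) (s≤s z≤n) (neo-balancingEq (suc n))

enumeration≗neoB : ∀ {b} → IsNeoBCEnumeration b → b ≗ neoB
enumeration≗neoB {b} (b0 , b-< , b-isNeoBC , b-complete) =
  increasing-same-image⇒≗ b-< neoB-< b⊆neoB neoB⊆b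
  where
  b⊆neoB : ∀ n → ∃ λ j → neoB j ≡ b n
  b⊆neoB zero = 0 , sym b0
  b⊆neoB (suc n) = isNeoBC⇒neoB (b-isNeoBC (suc n) (s≤s z≤n))
  neoB⊆b : ∀ n → ∃ λ j → b j ≡ neoB n
  neoB⊆b zero = 0 , b0
  neoB⊆b (suc n) = b-complete _ (neoB-isNeoBC n)

balancers≗neoR : ∀ {b r} → IsNeoBCEnumeration b → IsNeoBCBalancerSeq b r → r ≗ neoR
balancers≗neoR enum (r0 , _) zero = r0
balancers≗neoR {b} {r} enum (_ , balancer) (suc n) =
  balancingEq-unique {neoB (suc n)} balancing (neo-balancingEq (suc n))
  where
  balancing : NeoBalancingEq (neoB (suc n)) (r (suc n))
  balancing = subst (λ m → NeoBalancingEq m (r (suc n))) (enumeration≗neoB enum (suc n))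
                    (isNeoBalcobalancer⇒eq (balancer (suc n) (s≤s z≤n)))

integer-pell⇒pell : ∀ {m c} →
  ℤ.+ c ℤ.* ℤ.+ c ≡ ℤ.+ 8 ℤ.* ℤ.+ m ℤ.* ℤ.+ m ℤ.- ℤ.+ 12 ℤ.* ℤ.+ m ℤ.+ ℤ.+ 9 → NeoPell m c
integer-pell⇒pell {m} {c} pell = ℤ.+-injective (begin
  ℤ.+ (c * c + 12 * m)                                                 ≡⟨ cong₂ ℤ._+_ (ℤ.pos-* c c) (ℤ.pos-* 12 m) ⟩
  ℤ.+ c ℤ.* ℤ.+ c ℤ.+ ℤ.+ 12 ℤ.* ℤ.+ m                                 ≡⟨ cong (ℤ._+ ℤ.+ 12 ℤ.* ℤ.+ m) pell ⟩
  ℤ.+ 8 ℤ.* ℤ.+ m ℤ.* ℤ.+ m ℤ.- ℤ.+ 12 ℤ.* ℤ.+ m ℤ.+ ℤ.+ 9 ℤ.+ ℤ.+ 12 ℤ.* ℤ.+ m ≡⟨ cancel (ℤ.+ m) ⟩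
  ℤ.+ 8 ℤ.* ℤ.+ m ℤ.* ℤ.+ m ℤ.+ ℤ.+ 9                                  ≡⟨ cong (ℤ._+ ℤ.+ 9) cast ⟨
  ℤ.+ (8 * m * m + 9)                                                  ∎)
  where
  open ≡-Reasoning
  cancel : ∀ x → ℤ.+ 8 ℤ.* x ℤ.* x ℤ.- ℤ.+ 12 ℤ.* x ℤ.+ ℤ.+ 9 ℤ.+ ℤ.+ 12 ℤ.* x ≡ ℤ.+ 8 ℤ.* x ℤ.* x ℤ.+ ℤ.+ 9
  cancel = ℤ-Solver.solve-∀
  cast : ℤ.+ (8 * m * m) ≡ ℤ.+ 8 ℤ.* ℤ.+ m ℤ.* ℤ.+ m
  cast = trans (ℤ.pos-* (8 * m) m) (cong (ℤ._* ℤ.+ m) (ℤ.pos-* 8 m))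

cs≗neoC : ∀ {b c} → IsNeoBCEnumeration b → IsNeoBCCSeq b c → c ≗ neoC
cs≗neoC {b} {c} enum cs n =
  pell-unique {neoB n} (subst (λ m → NeoPell m (c n)) (enumeration≗neoB enum n) (integer-pell⇒pell {b n} {c n} (cs n)))
                       (neo-pell n)

neoCR : ℕ → ℕ
neoCR n = 17 * neoB n + 7 * neoQ n + 3

balancingEq⇒cr² : ∀ {d r} → NeoBalancingEq (d + r + 2) r → d * d ≡ 2 * r * r + 5 * r + 2
balancingEq⇒cr² {d} {r} eq = +-cancelʳ-≡ ((r + 2) * (2 * (d + r + 2) + r)) _ _ (begin
  d * d + (r + 2) * (2 * (d + r + 2) + r)                          ≡⟨ identity d r ⟩
  2 * r * r + 5 * r + 2 + ((d + r + 2) * (d + r + 2) + (r + 2))    ≡⟨ cong (2 * r * r + 5 * r + 2 +_) eq ⟩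
  2 * r * r + 5 * r + 2 + (r + 2) * (2 * (d + r + 2) + r)          ∎)
  where
  open ≡-Reasoning
  identity : ∀ d r → d * d + (r + 2) * (2 * (d + r + 2) + r)
                     ≡ 2 * r * r + 5 * r + 2 + ((d + r + 2) * (d + r + 2) + (r + 2))
  identity = solve-∀

neoB-suc≡neoCR+neoR+2 : ∀ n → neoB (suc n) ≡ neoCR n + neoR (suc n) + 2
neoB-suc≡neoCR+neoR+2 n = split (neoB n) (neoQ n)
  where
  split : ∀ B Q → 29 * B + 12 * Q + 6 ≡ 17 * B + 7 * Q + 3 + (1 + (12 * B + 5 * Q)) + 2
  split = solve-∀

crs≗neoCR : ∀ {b r cr} → IsNeoBCEnumeration b → IsNeoBCBalancerSeq b r → IsNeoBCCRSeq r cr →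
            ∀ n → cr (suc n) ≡ neoCR n
crs≗neoCR {b} {r} {cr} enum balancers crs n = m*m≡n*n⇒m≡n (begin
  cr (suc n) * cr (suc n)              ≡⟨ crs (suc n) ⟩
  2 * r′ * r′ + 5 * r′ + 2             ≡⟨ cong (λ t → 2 * t * t + 5 * t + 2) (balancers≗neoR enum balancers (suc n)) ⟩
  2 * R * R + 5 * R + 2                ≡⟨ balancingEq⇒cr² {neoCR n} eq ⟨
  neoCR n * neoCR n                    ∎)
  where
  open ≡-Reasoning
  r′ = r (suc n)
  R = neoR (suc n)
  eq : NeoBalancingEq (neoCR n + R + 2) R
  eq = subst (λ m → NeoBalancingEq m R) (neoB-suc≡neoCR+neoR+2 n) (neo-balancingEq (suc n))

-- The recurrences

Rec34 : (ℕ → ℕ) → ℕ → ℕ → Set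
Rec34 x κ₁ κ₂ = ∀ n → x (2 + n) + x n + κ₁ ≡ 34 * x (1 + n) + κ₂

Rec34-resp-≗ : ∀ {x y κ₁ κ₂} → x ≗ y → Rec34 y κ₁ κ₂ → Rec34 x κ₁ κ₂
Rec34-resp-≗ {x} {y} {κ₁} {κ₂} x≗y rec n = begin
  x (2 + n) + x n + κ₁    ≡⟨ cong₂ (λ s t → s + t + κ₁) (x≗y (2 + n)) (x≗y n) ⟩
  y (2 + n) + y n + κ₁    ≡⟨ rec n ⟩
  34 * y (1 + n) + κ₂     ≡⟨ cong (λ s → 34 * s + κ₂) (x≗y (1 + n)) ⟨
  34 * x (1 + n) + κ₂     ∎
  where open ≡-Reasoning

rec34⇒rec35 : ∀ {x κ₁ κ₂} → Rec34 x κ₁ κ₂ → ∀ n → Rec35 x (3 + n)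
rec34⇒rec35 {x} {κ₁} {κ₂} rec n = begin
  X (3 + n)                                ≡⟨ regroup (X (3 + n)) (X (2 + n)) (X (1 + n)) (X n) (ℤ.+ κ₁) (ℤ.+ κ₂) ⟩
  rhs ℤ.+ (defect (1 + n) ℤ.- defect n)    ≡⟨ cong₂ (λ s t → rhs ℤ.+ (s ℤ.- t)) (defect≡0 (1 + n)) (defect≡0 n) ⟩
  rhs ℤ.+ ℤ.0ℤ                             ≡⟨ ℤ.+-identityʳ rhs ⟩
  rhs                                      ∎
  where
  open ≡-Reasoning
  X : ℕ → ℤ
  X i = ℤ.+ x i
  rhs : ℤ
  rhs = ℤ.+ 35 ℤ.* X (2 + n) ℤ.- ℤ.+ 35 ℤ.* X (1 + n) ℤ.+ X n
  defect : ℕ → ℤ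
  defect i = (X (2 + i) ℤ.+ X i ℤ.+ ℤ.+ κ₁) ℤ.- (ℤ.+ 34 ℤ.* X (1 + i) ℤ.+ ℤ.+ κ₂)
  defect≡0 : ∀ i → defect i ≡ ℤ.0ℤ
  defect≡0 i = ℤ.i≡j⇒i-j≡0 (trans (cong ℤ.+_ (rec i)) (cong (ℤ._+ ℤ.+ κ₂) (ℤ.pos-* 34 (x (1 + i)))))
  regroup : ∀ x₃ x₂ x₁ x₀ k₁ k₂ →
            x₃ ≡ ℤ.+ 35 ℤ.* x₂ ℤ.- ℤ.+ 35 ℤ.* x₁ ℤ.+ x₀
                 ℤ.+ ((x₃ ℤ.+ x₁ ℤ.+ k₁ ℤ.- (ℤ.+ 34 ℤ.* x₂ ℤ.+ k₂)) ℤ.- (x₂ ℤ.+ x₀ ℤ.+ k₁ ℤ.- (ℤ.+ 34 ℤ.* x₁ ℤ.+ k₂)))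
  regroup = ℤ-Solver.solve-∀

neoB-rec34 : Rec34 neoB 24 0
neoB-rec34 n = identity (neoB n) (neoQ n)
  where
  identity : ∀ B Q → let B₁ = 29 * B + 12 * Q + 6; Q₁ = 12 * B + 5 * Q in
             29 * B₁ + 12 * Q₁ + 6 + B + 24 ≡ 34 * B₁ + 0
  identity = solve-∀

neoR-rec34 : Rec34 neoR 0 40
neoR-rec34 n = identity (neoB n) (neoQ n)
  where
  identity : ∀ B Q → let B₁ = 29 * B + 12 * Q + 6; Q₁ = 12 * B + 5 * Q in
             1 + (12 * B₁ + 5 * Q₁) + (1 + Q) + 0 ≡ 34 * (1 + Q₁) + 40
  identity = solve-∀

neoC-rec34 : Rec34 neoC 0 0
neoC-rec34 n = identity (neoB n) (neoQ n)
  where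
  identity : ∀ B Q → let B₁ = 29 * B + 12 * Q + 6; Q₁ = 12 * B + 5 * Q
                         B₂ = 29 * B₁ + 12 * Q₁ + 6; Q₂ = 12 * B₁ + 5 * Q₁ in
             2 * B₂ + 2 * (1 + Q₂) + 1 + (2 * B + 2 * (1 + Q) + 1) + 0 ≡ 34 * (2 * B₁ + 2 * (1 + Q₁) + 1) + 0
  identity = solve-∀

neoCR-rec34 : Rec34 neoCR 0 0
neoCR-rec34 n = identity (neoB n) (neoQ n)
  where
  identity : ∀ B Q → let B₁ = 29 * B + 12 * Q + 6; Q₁ = 12 * B + 5 * Q
                         B₂ = 29 * B₁ + 12 * Q₁ + 6; Q₂ = 12 * B₁ + 5 * Q₁ in
             17 * B₂ + 7 * Q₂ + 3 + (17 * B + 7 * Q + 3) + 0 ≡ 34 * (17 * B₁ + 7 * Q₁ + 3) + 0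
  identity = solve-∀

theorem3p2 : (b r c cr : ℕ → ℕ) →
    IsNeoBCEnumeration b → IsNeoBCBalancerSeq b r → IsNeoBCCSeq b c → IsNeoBCCRSeq r cr →
    (∀ n → 3 ≤ n → Rec35 b n × Rec35 c n × Rec35 r n)
    × (∀ n → 4 ≤ n → Rec35 cr n)
theorem3p2 b r c cr enum balancers cs crs = rec-b-c-r , rec-cr
  where
  rec-b-c-r : ∀ n → 3 ≤ n → Rec35 b n × Rec35 c n × Rec35 r n
  rec-b-c-r _ (s≤s (s≤s (s≤s {n = n} _))) =
    rec34⇒rec35 {b} (Rec34-resp-≗ {b} (enumeration≗neoB enum) neoB-rec34) n ,
    rec34⇒rec35 {c} (Rec34-resp-≗ {c} (cs≗neoC enum cs) neoC-rec34) n ,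
    rec34⇒rec35 {r} (Rec34-resp-≗ {r} (balancers≗neoR enum balancers) neoR-rec34) n
  rec-cr : ∀ n → 4 ≤ n → Rec35 cr n
  rec-cr _ (s≤s (s≤s (s≤s (s≤s {n = n} _)))) =
    rec34⇒rec35 {λ i → cr (suc i)} (Rec34-resp-≗ {λ i → cr (suc i)} (crs≗neoCR {b} {r} {cr} enum balancers crs) neoCR-rec34) n
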